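{- $\mu\text{ - }\mathsf{rec}\preceq\mathsf{WCBV}$.
   Context: A many-one reduction $P\preceq Q$ is a function $f$, definable in constructive type theory without axioms (hence computable), with $P\,x\leftrightarrow Q(f\,x)$ for all instances $x$. $\mu$-recursive algorithms of arity $k$ are built as follows. - $\mathrm{cst}_n$ has arity $0$. - $\mathrm{zero}$ and $\mathrm{succ}$ have arity $1$. - $\mathrm{prj}_p$ has arity $k$, for $p<k$. - $\mathrm{comp}\,f\,\vec g$ has arity $i$, for $f$ of arity $k$ and $\vec g$ a vector of $k$ algorithms of arity $i$. - $\mathrm{rec}\,f\,g$ has arity $1+k$, for $f$ of arity $k$ and $g$ of arity $2+k$. - $\mu f$ has arity $k$, for $f$ of arity $1+k$. Their relational semantics $[\![f]\!]\,\vec v\,x$ is defined as follows. - $[\![\mathrm{cst}_n]\!]\vec v\,x\iff x=n$. - $[\![\mathrm{zero}]\!]\vec v\,x\iff x=0$. - $[\![\mathrm{succ}]\!]\vec v\,x\iff x=v_0+1$. - $[\![\mathrm{prj}_p]\!]\vec v\,x\iff x=v_p$. - $[\![\mathrm{comp}\,f\,\vec g]\!]\vec v\,x\iff\exists\vec w,\ [\![f]\!]\vec w\,x\wedge\forall p,\ [\![g_p]\!]\vec v\,w_p$. - $[\![\mathrm{rec}\,f\,g]\!](0::\vec v)\,x\iff[\![f]\!]\vec v\,x$. - $[\![\mathrm{rec}\,f\,g]\!]((m+1)::\vec v)\,x\iff\exists y,\ [\![\mathrm{rec}\,f\,g]\!](m::\vec v)\,y\wedge[\![g]\!](m::y::\vec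 v)\,x$. - $[\![\mu f]\!]\vec v\,x\iff[\![f]\!](x::\vec v)\,0\wedge\forall y<x\,\exists z,\ [\![f]\!](y::\vec v)(1+z)$. $\mu\text{ - }\mathsf{rec}$: given $k$, an algorithm $f$ of arity $k$ and $\vec v\in\mathbb N^k$, is there $x$ with $[\![f]\!]\vec v\,x$? The weak call-by-value $\lambda$-calculus L has terms $s,t::=n\mid s\,t\mid\lambda s$ ($n\in\mathbb N$, De Bruijn indices). Evaluation $s\triangleright t$ is defined inductively. - $\lambda s\triangleright\lambda s$. - $s\,t\triangleright u$ whenever $s\triangleright\lambda s'$, $t\triangleright t'$ and $s'[t'/0]\triangleright u$, where $s'[t'/0]$ substitutes $t'$ for De Bruijn index $0$. $\mathsf{WCBV}$: given a term $s$, is there $t$ with $s\triangleright t$? -}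

module Defs where

open import Level using (Level; _⊔_)
open import Data.Nat using (ℕ; zero; suc; _<_; _≡ᵇ_)
open import Data.Bool using (if_then_else_)
open import Data.Fin using (Fin)
open import Data.Vec using (Vec; []; _∷_; lookup)
open import Data.Product using (Σ; ∃; _×_; _,_)
open import Function.Bundles using (_⇔_)

-- Many-one reductions (functions in Agda's --safe constructive type
-- theory, hence computable)

_⪯_ : ∀ {a b p q : Level} {X : Set a} {Y : Set b}
      → (X → Set p) → (Y → Set q) → Set (a ⊔ b ⊔ p ⊔ q)
_⪯_ {X = X} {Y = Y} P Q = Σ (X → Y) λ f → ∀ x → P x ⇔ Q (f x)

data Recalg : ℕ → Set where
  cst  : ℕ → Recalg 0
  zer  : Recalg 1
  succ : Recalg 1
  prj  : ∀ {k} → Fin k → Recalg k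
  comp : ∀ {k i} → Recalg k → Vec (Recalg i) k → Recalg i
  rec  : ∀ {k} → Recalg k → Recalg (suc (suc k)) → Recalg (suc k)
  mu   : ∀ {k} → Recalg (suc k) → Recalg k

data ⟦_⟧ : ∀ {k} → Recalg k → Vec ℕ k → ℕ → Set where
  e-cst  : ∀ {n} → ⟦ cst n ⟧ [] n
  e-zer  : ∀ {v} → ⟦ zer ⟧ v 0
  e-succ : ∀ {n} → ⟦ succ ⟧ (n ∷ []) (suc n)
  e-prj  : ∀ {k} {p : Fin k} {v} → ⟦ prj p ⟧ v (lookup v p)
  e-comp : ∀ {k i} {f : Recalg k} {gs : Vec (Recalg i) k} {v x}
           (w : Vec ℕ k) → ⟦ f ⟧ w x
           → (∀ p → ⟦ lookup gs p ⟧ v (lookup w p))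
           → ⟦ comp f gs ⟧ v x
  e-rec0 : ∀ {k} {f : Recalg k} {g} {v x}
           → ⟦ f ⟧ v x → ⟦ rec f g ⟧ (0 ∷ v) x
  e-recS : ∀ {k} {f : Recalg k} {g} {m v x} (y : ℕ)
           → ⟦ rec f g ⟧ (m ∷ v) y → ⟦ g ⟧ (m ∷ y ∷ v) x
           → ⟦ rec f g ⟧ (suc m ∷ v) x
  e-mu   : ∀ {k} {f : Recalg (suc k)} {v x}
           → ⟦ f ⟧ (x ∷ v) 0
           → (∀ y → y < x → ∃ λ z → ⟦ f ⟧ (y ∷ v) (suc z))
           → ⟦ mu f ⟧ v x

MuRecInst : Set
MuRecInst = Σ ℕ λ k → Recalg k × Vec ℕ k

μ-rec : MuRecInst → Set
μ-rec (k , f , v) = ∃ λ x → ⟦ f ⟧ v x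

data Term : Set where
  var : ℕ → Term
  app : Term → Term → Term
  lam : Term → Term

-- s [u / k] : replace De Bruijn index k (relative to the binders passed)
-- by u (L's substitution; u is not shifted)
_[_/_] : Term → Term → ℕ → Term
var n   [ u / k ] = if n ≡ᵇ k then u else var n
app s t [ u / k ] = app (s [ u / k ]) (t [ u / k ])
lam s   [ u / k ] = lam (s [ u / suc k ])

data _▷_ : Term → Term → Set where
  ev-lam : ∀ {s} → lam s ▷ lam s
  ev-app : ∀ {s t s′ t′ u}
           → s ▷ lam s′ → t ▷ t′ → (s′ [ t′ / 0 ]) ▷ u
           → app s t ▷ u

WCBV : Term → Set
WCBV s = ∃ λ t → s ▷ t

module Submission where

-- Every μ-recursive algorithm f is compiled to a closed L-term ⌜f⌝ acting on Scott-encoded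
-- numbers and vectors; the reduction maps (f, v) to the application ⌜f⌝ ⌜v⌝.  Primitive
-- recursion and minimisation become loops by self-application.  Completeness
-- (⟦ f ⟧ v x implies ⌜f⌝ ⌜v⌝ ▷ ⌜x⌝) is an induction on the semantics.  For soundness,
-- evaluation derivations are transported along the unfoldings of compiled code, which
-- preserve values and never enlarge derivations; each round of the μ-loop strictly shrinks
-- the derivation, so the unbounded search is handled by induction on its size.

open import Defs
open import Data.Nat using (ℕ; zero; suc; _+_; _≤_; _<_; _≡ᵇ_; _<ᵇ_; z≤n; s≤s)
open import Data.Nat.Properties
  using ( +-monoˡ-≤; +-monoʳ-≤; ≤-refl; ≤-trans; ≤-reflexive; ≤-<-trans; <⇒≤; <⇒≢; ≤⇒≯
        ; <ᵇ⇒<; ≡ᵇ⇒≡; m≤n⇒m<n∨m≡n; m≤n+m; +-suc; +-identityʳ )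
open import Data.Bool using (Bool; true; false; _∧_; if_then_else_; T)
open import Data.Bool.Properties using (T-∧)
open import Data.Empty using (⊥-elim)
open import Data.Sum using (inj₁; inj₂)
open import Data.Fin using (Fin; zero; suc)
open import Data.Vec using (Vec; []; _∷_; lookup)
open import Data.Product using (Σ; ∃; _×_; _,_; proj₁; proj₂)
open import Relation.Binary.PropositionalEquality using (_≡_; refl; sym; cong; cong₂; subst)
open import Function.Bundles using (mk⇔; Equivalence)

record Closed (t : Term) : Set where
  constructor closed
  field fixed : ∀ k u → t [ u / k ] ≡ t

-- Substituting into a constant is the identity,
-- so instantiating a Tm computes definitionally, even for constants such as the numeral
-- of an unknown n or the compiled code of an unknown algorithm.
data Tm : Set where
  V   : ℕ → Tm
  _∙_ : Tm → Tm → Tm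
  ƛ   : Tm → Tm
  K   : (t : Term) → Closed t → Tm
infixl 7 _∙_

⌊_⌋ : Tm → Term
⌊ V i ⌋   = var i
⌊ s ∙ t ⌋ = app ⌊ s ⌋ ⌊ t ⌋
⌊ ƛ s ⌋   = lam ⌊ s ⌋
⌊ K t _ ⌋ = t

inst : ℕ → Tm → (a : Term) → Closed a → Tm
inst k (V i)   a ca = if i ≡ᵇ k then K a ca else V i
inst k (s ∙ t) a ca = inst k s a ca ∙ inst k t a ca
inst k (ƛ s)   a ca = ƛ (inst (suc k) s a ca)
inst k (K t p) a ca = K t p

⌊⌋-inst : ∀ k t a ca → ⌊ t ⌋ [ a / k ] ≡ ⌊ inst k t a ca ⌋
⌊⌋-inst k (V i) a ca with i ≡ᵇ k
... | true  = refl
... | false = refl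
⌊⌋-inst k (s ∙ t) a ca = cong₂ app (⌊⌋-inst k s a ca) (⌊⌋-inst k t a ca)
⌊⌋-inst k (ƛ s)   a ca = cong lam (⌊⌋-inst (suc k) s a ca)
⌊⌋-inst k (K t p) a ca = Closed.fixed p k a

scoped : ℕ → Tm → Bool
scoped n (V i)   = i <ᵇ n
scoped n (s ∙ t) = scoped n s ∧ scoped n t
scoped n (ƛ s)   = scoped (suc n) s
scoped n (K _ _) = true

scoped⇒fixed : ∀ n t → T (scoped n t) → ∀ k → n ≤ k → ∀ u → ⌊ t ⌋ [ u / k ] ≡ ⌊ t ⌋
scoped⇒fixed n (V i) i<n k n≤k u with i ≡ᵇ k in i≡k
... | false = refl
... | true  = ⊥-elim (<⇒≢ (≤-trans (<ᵇ⇒< i n i<n) n≤k) (≡ᵇ⇒≡ i k (subst T (sym i≡k) _)))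
scoped⇒fixed n (s ∙ t) st k n≤k u =
  cong₂ app (scoped⇒fixed n s (proj₁ st′) k n≤k u) (scoped⇒fixed n t (proj₂ st′) k n≤k u)
  where st′ = Equivalence.to T-∧ st
scoped⇒fixed n (ƛ s)   ss k n≤k u = cong lam (scoped⇒fixed (suc n) s ss (suc k) (s≤s n≤k) u)
scoped⇒fixed n (K t p) _  k _   u = Closed.fixed p k u

closedTm : (t : Tm) {_ : T (scoped 0 t)} → Closed ⌊ t ⌋
closedTm t {st} = closed λ k u → scoped⇒fixed 0 t st k z≤n u

size : ∀ {s t} → s ▷ t → ℕ
size ev-lam            = 0
size (ev-app d₁ d₂ d₃) = suc (size d₁ + size d₂ + size d₃)

▷-deterministic : ∀ {s t t′} → s ▷ t → s ▷ t′ → t ≡ t′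
▷-deterministic ev-lam ev-lam = refl
▷-deterministic (ev-app d₁ d₂ d₃) (ev-app e₁ e₂ e₃)
  with ▷-deterministic d₁ e₁ | ▷-deterministic d₂ e₂
... | refl | refl = ▷-deterministic d₃ e₃

cast▷ : ∀ {s s′ u} → s ≡ s′ → (d : s ▷ u) → Σ (s′ ▷ u) λ d′ → size d′ ≡ size d
cast▷ refl d = d , refl

record _⟶_ (s s′ : Term) : Set where
  field
    forward  : ∀ {u} (d : s ▷ u) → Σ (s′ ▷ u) λ d′ → size d′ ≤ size d
    backward : ∀ {u} → s′ ▷ u → s ▷ u
open _⟶_

record _⟶⁺_ (s s′ : Term) : Set where
  field
    forward⁺  : ∀ {u} (d : s ▷ u) → Σ (s′ ▷ u) λ d′ → size d′ < size d
    backward⁺ : ∀ {u} → s′ ▷ u → s ▷ u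
open _⟶⁺_

⟶⁺⇒⟶ : ∀ {s s′} → s ⟶⁺ s′ → s ⟶ s′
⟶⁺⇒⟶ r = record
  { forward  = λ d → let d′ , lt = forward⁺ r d in d′ , <⇒≤ lt
  ; backward = backward⁺ r
  }

infixr 4 _⨾_ _⁺⨾_ _⨾⁺_

_⨾_ : ∀ {s t u} → s ⟶ t → t ⟶ u → s ⟶ u
r ⨾ q = record
  { forward  = λ d → let d′ , le = forward r d ; d″ , le′ = forward q d′ in d″ , ≤-trans le′ le
  ; backward = λ d → backward r (backward q d)
  }

_⁺⨾_ : ∀ {s t u} → s ⟶⁺ t → t ⟶ u → s ⟶⁺ u
r ⁺⨾ q = record
  { forward⁺  = λ d → let d′ , lt = forward⁺ r d ; d″ , le = forward q d′ in d″ , ≤-<-trans le lt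
  ; backward⁺ = λ d → backward⁺ r (backward q d)
  }

_⨾⁺_ : ∀ {s t u} → s ⟶ t → t ⟶⁺ u → s ⟶⁺ u
r ⨾⁺ q = record
  { forward⁺  = λ d → let d′ , le = forward r d ; d″ , lt = forward⁺ q d′ in d″ , ≤-trans lt le
  ; backward⁺ = λ d → backward r (backward⁺ q d)
  }

app-congˡ : ∀ {s s′ t} → s ⟶ s′ → app s t ⟶ app s′ t
app-congˡ {s} {s′} {t} r = record
  { forward  = fw
  ; backward = λ { (ev-app d₁ d₂ d₃) → ev-app (backward r d₁) d₂ d₃ }
  }
  where
  fw : ∀ {u} (d : app s t ▷ u) → Σ (app s′ t ▷ u) λ d′ → size d′ ≤ size d
  fw (ev-app d₁ d₂ d₃) = let d₁′ , le = forward r d₁ in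
    ev-app d₁′ d₂ d₃ , s≤s (+-monoˡ-≤ (size d₃) (+-monoˡ-≤ (size d₂) le))

app-congʳ : ∀ {s t t′} → t ⟶ t′ → app s t ⟶ app s t′
app-congʳ {s} {t} {t′} r = record
  { forward  = fw
  ; backward = λ { (ev-app d₁ d₂ d₃) → ev-app d₁ (backward r d₂) d₃ }
  }
  where
  fw : ∀ {u} (d : app s t ▷ u) → Σ (app s t′ ▷ u) λ d′ → size d′ ≤ size d
  fw (ev-app d₁ d₂ d₃) = let d₂′ , le = forward r d₂ in
    ev-app d₁ d₂′ d₃ , s≤s (+-monoˡ-≤ (size d₃) (+-monoʳ-≤ (size d₁) le))

▷⇒⟶ : ∀ {t b} → t ▷ lam b → t ⟶ lam b
▷⇒⟶ {t} {b} e = record { forward = fw ; backward = λ { ev-lam → e } }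
  where
  fw : ∀ {u} (d : t ▷ u) → Σ (lam b ▷ u) λ d′ → size d′ ≤ size d
  fw d with ▷-deterministic e d
  ... | refl = ev-lam , z≤n

⟶-pres : ∀ {s s′ u} → s ⟶ s′ → s ▷ u → s′ ▷ u
⟶-pres r d = proj₁ (forward r d)

⟶-value : ∀ {s b u} → s ⟶ lam b → s ▷ u → u ≡ lam b
⟶-value r d with forward r d
... | ev-lam , _ = refl

⟶-eval : ∀ {s b} → s ⟶ lam b → s ▷ lam b
⟶-eval r = backward r ev-lam

β⁺ : (b : Tm) {a : Term} (ca : Closed (lam a)) → app (lam ⌊ b ⌋) (lam a) ⟶⁺ ⌊ inst 0 b (lam a) ca ⌋
β⁺ b ca = record
  { forward⁺  = λ { (ev-app ev-lam ev-lam d) →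
                    let d′ , eq = cast▷ (⌊⌋-inst 0 b _ ca) d in d′ , s≤s (≤-reflexive eq) }
  ; backward⁺ = λ d → ev-app ev-lam ev-lam (proj₁ (cast▷ (sym (⌊⌋-inst 0 b _ ca)) d))
  }

β : (b : Tm) {a : Term} (ca : Closed (lam a)) → app (lam ⌊ b ⌋) (lam a) ⟶ ⌊ inst 0 b (lam a) ca ⌋
β b ca = ⟶⁺⇒⟶ (β⁺ b ca)

β₂ : (b : Tm) {a₁ a₂ : Term} (c₁ : Closed (lam a₁)) (c₂ : Closed (lam a₂))
   → app (app (lam ⌊ ƛ b ⌋) (lam a₁)) (lam a₂) ⟶ ⌊ inst 0 (inst 1 b (lam a₁) c₁) (lam a₂) c₂ ⌋
β₂ b c₁ c₂ = app-congˡ (β (ƛ b) c₁) ⨾ β (inst 1 b _ c₁) c₂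

β⁺₃ : (b : Tm) {a₁ a₂ a₃ : Term}
      (c₁ : Closed (lam a₁)) (c₂ : Closed (lam a₂)) (c₃ : Closed (lam a₃))
    → app (app (app (lam ⌊ ƛ (ƛ b) ⌋) (lam a₁)) (lam a₂)) (lam a₃)
      ⟶⁺ ⌊ inst 0 (inst 1 (inst 2 b (lam a₁) c₁) (lam a₂) c₂) (lam a₃) c₃ ⌋
β⁺₃ b c₁ c₂ c₃ = app-congˡ (β₂ (ƛ b) c₁ c₂) ⨾⁺ β⁺ (inst 1 (inst 2 b _ c₁) _ c₂) c₃

mutual
  nat : ℕ → Term
  nat n = lam ⌊ natB n ⌋

  natB : ℕ → Tm
  natB zero    = ƛ (V 1)
  natB (suc n) = ƛ (V 0 ∙ K (nat n) (nat-closed n))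

  nat-closed : ∀ n → Closed (nat n)
  nat-closed zero    = closedTm (ƛ (natB zero))
  nat-closed (suc n) = closedTm (ƛ (natB (suc n)))

natK : ℕ → Tm
natK n = K (nat n) (nat-closed n)

mutual
  vec : ∀ {k} → Vec ℕ k → Term
  vec v = lam ⌊ vecB v ⌋

  vecB : ∀ {k} → Vec ℕ k → Tm
  vecB []      = ƛ (V 1)
  vecB (h ∷ t) = ƛ (V 0 ∙ natK h ∙ K (vec t) (vec-closed t))

  vec-closed : ∀ {k} (v : Vec ℕ k) → Closed (vec v)
  vec-closed []      = closedTm (ƛ (vecB []))
  vec-closed (h ∷ t) = closedTm (ƛ (vecB (h ∷ t)))

vecK : ∀ {k} → Vec ℕ k → Tm
vecK v = K (vec v) (vec-closed v)

consT : Term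
consT = ⌊ ƛ (ƛ (ƛ (ƛ (V 0 ∙ V 3 ∙ V 2)))) ⌋

consK : Tm
consK = K consT (closedTm (ƛ (ƛ (ƛ (ƛ (V 0 ∙ V 3 ∙ V 2))))))

succT : Term
succT = ⌊ ƛ (ƛ (ƛ (V 0 ∙ V 2))) ⌋

succK : Tm
succK = K succT (closedTm (ƛ (ƛ (ƛ (V 0 ∙ V 2)))))

-- Case branches are guarded by an abstraction and then applied to `dummy`,
-- so that call-by-value evaluates only the chosen branch.
dummy : Term
dummy = nat 0

dummyK : Tm
dummyK = natK 0

nat-case-zero : (a : Tm) {_ : T (scoped 1 a)} {b : Term} (cb : Closed (lam b))
              → app (app (app (nat 0) (lam ⌊ a ⌋)) (lam b)) dummy
                ⟶ ⌊ inst 0 a dummy (nat-closed 0) ⌋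
nat-case-zero a {sa} cb = app-congˡ (β₂ (V 1) (closedTm (ƛ a) {sa}) cb) ⨾ β a (nat-closed 0)

nat-case-suc : ∀ m {a : Term} (ca : Closed (lam a)) (b : Tm) {_ : T (scoped 2 b)}
             → app (app (app (nat (suc m)) (lam a)) (lam ⌊ ƛ b ⌋)) dummy
               ⟶ ⌊ inst 0 (inst 1 b (nat m) (nat-closed m)) dummy (nat-closed 0) ⌋
nat-case-suc m ca b {sb} =
  app-congˡ (β₂ (V 0 ∙ natK m) ca (closedTm (ƛ (ƛ b)) {sb})) ⨾ β₂ b (nat-closed m) (nat-closed 0)

vec-case-cons : ∀ {k} h (t : Vec ℕ k) {a : Term} (ca : Closed (lam a)) (b : Tm) {_ : T (scoped 2 b)}
              → app (app (vec (h ∷ t)) (lam a)) (lam ⌊ ƛ b ⌋)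
                ⟶ ⌊ inst 0 (inst 1 b (nat h) (nat-closed h)) (vec t) (vec-closed t) ⌋
vec-case-cons h t ca b {sb} =
  β₂ (V 0 ∙ natK h ∙ vecK t) ca (closedTm (ƛ (ƛ b)) {sb}) ⨾ β₂ b (nat-closed h) (vec-closed t)

cons-⟶ : ∀ {k} h (t : Vec ℕ k) → app (app consT (nat h)) (vec t) ⟶ vec (h ∷ t)
cons-⟶ h t = β₂ (ƛ (ƛ (V 0 ∙ V 3 ∙ V 2))) (nat-closed h) (vec-closed t)

succ-⟶ : ∀ n → app succT (nat n) ⟶ nat (suc n)
succ-⟶ n = β (ƛ (ƛ (V 0 ∙ V 2))) (nat-closed n)

mutual
  compile : ∀ {k} → Recalg k → Term
  compile f = lam ⌊ compileB f ⌋

  compileK : ∀ {k} → Recalg k → Tm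
  compileK f = K (compile f) (compile-closed f)

  compileAll : ∀ {i k} → Vec (Recalg i) k → Term
  compileAll gs = lam ⌊ compileAllB gs ⌋

  compileAllK : ∀ {i k} → Vec (Recalg i) k → Tm
  compileAllK gs = K (compileAll gs) (compileAll-closed gs)

  compileB : ∀ {k} → Recalg k → Tm
  compileB (cst n)       = natK n
  compileB zer           = natK 0
  compileB succ          = V 0 ∙ dummyK ∙ ƛ (ƛ (ƛ (ƛ (V 0 ∙ V 3))))
  compileB (prj zero)    = V 0 ∙ dummyK ∙ ƛ (ƛ (V 1))
  compileB (prj (suc p)) = V 0 ∙ dummyK ∙ ƛ (ƛ (compileK (prj p) ∙ V 0))
  compileB (comp f gs)   = compileK f ∙ (compileAllK gs ∙ V 0)
  compileB (rec f g)     = V 0 ∙ dummyK ∙ ƛ (ƛ (recLoopK f g ∙ recLoopK f g ∙ V 1 ∙ V 0))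
  compileB (mu f)        = searchLoopK f ∙ searchLoopK f ∙ natK 0 ∙ V 0

  compileAllB : ∀ {i k} → Vec (Recalg i) k → Tm
  compileAllB []       = vecK []
  compileAllB (g ∷ gs) = consK ∙ (compileK g ∙ V 0) ∙ (compileAllK gs ∙ V 0)

  -- λ self m v. m (λ _. ⌜f⌝ v) (λ m′ _. ⌜g⌝ (m′ ∷ self self m′ v ∷ v)) dummy
  recLoop : ∀ {k} → Recalg k → Recalg (suc (suc k)) → Term
  recLoop f g = lam ⌊ ƛ (ƛ (recBody f g)) ⌋

  recBody : ∀ {k} → Recalg k → Recalg (suc (suc k)) → Tm
  recBody f g = V 1 ∙ ƛ (compileK f ∙ V 1)
                    ∙ ƛ (ƛ (compileK g ∙ (consK ∙ V 1 ∙ (consK ∙ (V 4 ∙ V 4 ∙ V 1 ∙ V 2) ∙ V 2))))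
                    ∙ dummyK

  recLoopK : ∀ {k} → Recalg k → Recalg (suc (suc k)) → Tm
  recLoopK f g = K (recLoop f g) (closedTm (ƛ (ƛ (ƛ (recBody f g)))))

  -- λ self y v. ⌜f⌝ (y ∷ v) (λ _. y) (λ z _. self self (y + 1) v) dummy
  searchLoop : ∀ {k} → Recalg (suc k) → Term
  searchLoop f = lam ⌊ ƛ (ƛ (searchBody f)) ⌋

  searchBody : ∀ {k} → Recalg (suc k) → Tm
  searchBody f = compileK f ∙ (consK ∙ V 1 ∙ V 0) ∙ ƛ (V 2)
                   ∙ ƛ (ƛ (V 4 ∙ V 4 ∙ (succK ∙ V 3) ∙ V 2)) ∙ dummyK

  searchLoopK : ∀ {k} → Recalg (suc k) → Tm
  searchLoopK f = K (searchLoop f) (closedTm (ƛ (ƛ (ƛ (searchBody f)))))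

  compile-closed : ∀ {k} (f : Recalg k) → Closed (compile f)
  compile-closed (cst n)        = closedTm (ƛ (compileB (cst n)))
  compile-closed zer            = closedTm (ƛ (compileB zer))
  compile-closed succ           = closedTm (ƛ (compileB succ))
  compile-closed {k} (prj zero) = closedTm (ƛ (compileB (prj {k} zero)))
  compile-closed (prj (suc p))  = closedTm (ƛ (compileB (prj (suc p))))
  compile-closed (comp f gs)    = closedTm (ƛ (compileB (comp f gs)))
  compile-closed (rec f g)      = closedTm (ƛ (compileB (rec f g)))
  compile-closed (mu f)         = closedTm (ƛ (compileB (mu f)))

  compileAll-closed : ∀ {i k} (gs : Vec (Recalg i) k) → Closed (compileAll gs)
  compileAll-closed {i} []   = closedTm (ƛ (compileAllB {i} []))
  compileAll-closed (g ∷ gs) = closedTm (ƛ (compileAllB (g ∷ gs)))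

compile-β : ∀ {k} (f : Recalg k) (v : Vec ℕ k)
          → app (compile f) (vec v) ⟶ ⌊ inst 0 (compileB f) (vec v) (vec-closed v) ⌋
compile-β f v = β (compileB f) (vec-closed v)

compileAll-β : ∀ {i k} (gs : Vec (Recalg i) k) (v : Vec ℕ i)
             → app (compileAll gs) (vec v) ⟶ ⌊ inst 0 (compileAllB gs) (vec v) (vec-closed v) ⌋
compileAll-β gs v = β (compileAllB gs) (vec-closed v)

compile-succ : ∀ n → app (compile succ) (vec (n ∷ [])) ⟶ nat (suc n)
compile-succ n = compile-β succ (n ∷ []) ⨾ vec-case-cons n [] (nat-closed 0) (ƛ (ƛ (V 0 ∙ V 3)))

compile-prj : ∀ {k} (p : Fin k) v → app (compile (prj p)) (vec v) ⟶ nat (lookup v p)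
compile-prj zero (h ∷ t) = compile-β (prj zero) (h ∷ t) ⨾ vec-case-cons h t (nat-closed 0) (V 1)
compile-prj (suc p) (h ∷ t) =
  compile-β (prj (suc p)) (h ∷ t)
  ⨾ vec-case-cons h t (nat-closed 0) (compileK (prj p) ∙ V 0)
  ⨾ compile-prj p t

compile-args : ∀ {i k} (g : Recalg i) (gs : Vec (Recalg i) k) (v : Vec ℕ i) x (w : Vec ℕ k)
             → app (compile g) (vec v) ▷ nat x → app (compileAll gs) (vec v) ▷ vec w
             → app (app consT (app (compile g) (vec v))) (app (compileAll gs) (vec v)) ⟶ vec (x ∷ w)
compile-args g gs v x w dg dgs = app-congˡ (app-congʳ (▷⇒⟶ dg)) ⨾ app-congʳ (▷⇒⟶ dgs) ⨾ cons-⟶ x w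

recCall : ∀ {k} → Recalg k → Recalg (suc (suc k)) → ℕ → Vec ℕ k → Term
recCall f g m v = app (app (app (recLoop f g) (recLoop f g)) (nat m)) (vec v)

compile-rec : ∀ {k} f g m (v : Vec ℕ k) → app (compile (rec f g)) (vec (m ∷ v)) ⟶ recCall f g m v
compile-rec f g m v =
  compile-β (rec f g) (m ∷ v)
  ⨾ vec-case-cons m v (nat-closed 0) (recLoopK f g ∙ recLoopK f g ∙ V 1 ∙ V 0)

recZeroBranch : ∀ {k} → Recalg k → Vec ℕ k → Tm
recZeroBranch f v = compileK f ∙ vecK v

recSucBranch : ∀ {k} → Recalg k → Recalg (suc (suc k)) → Vec ℕ k → Tm
recSucBranch f g v =
  compileK g ∙ (consK ∙ V 1 ∙ (consK ∙ (recLoopK f g ∙ recLoopK f g ∙ V 1 ∙ vecK v) ∙ vecK v))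

recCall-unfold : ∀ {k} f g m (v : Vec ℕ k)
               → recCall f g m v
                 ⟶ app (app (app (nat m) (lam ⌊ recZeroBranch f v ⌋))
                             (lam ⌊ ƛ (recSucBranch f g v) ⌋))
                        dummy
recCall-unfold f g m v =
  ⟶⁺⇒⟶ (β⁺₃ (recBody f g) (closedTm (ƛ (ƛ (ƛ (recBody f g))))) (nat-closed m) (vec-closed v))

recCall-zero : ∀ {k} f g (v : Vec ℕ k) → recCall f g 0 v ⟶ app (compile f) (vec v)
recCall-zero f g v =
  recCall-unfold f g 0 v ⨾ nat-case-zero (recZeroBranch f v) (closedTm (ƛ (ƛ (recSucBranch f g v))))

recCall-suc : ∀ {k} f g m (v : Vec ℕ k)
            → recCall f g (suc m) v
              ⟶ app (compile g)
                    (app (app consT (nat m)) (app (app consT (recCall f g m v)) (vec v)))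
recCall-suc f g m v =
  recCall-unfold f g (suc m) v
  ⨾ nat-case-suc m (closedTm (ƛ (recZeroBranch f v))) (recSucBranch f g v)

recCall-args : ∀ {k} (f : Recalg k) (g : Recalg (suc (suc k))) m (v : Vec ℕ k) y
             → recCall f g m v ▷ nat y
             → app (compile g) (app (app consT (nat m)) (app (app consT (recCall f g m v)) (vec v)))
               ⟶ app (compile g) (vec (m ∷ y ∷ v))
recCall-args f g m v y dr =
  app-congʳ (app-congʳ (app-congˡ (app-congʳ (▷⇒⟶ dr)) ⨾ cons-⟶ y v)) ⨾ app-congʳ (cons-⟶ m (y ∷ v))

search : ∀ {k} → Recalg (suc k) → ℕ → Vec ℕ k → Term
search f y v = app (app (app (searchLoop f) (searchLoop f)) (nat y)) (vec v)

searchNext : ∀ {k} → Recalg (suc k) → ℕ → Vec ℕ k → Tm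
searchNext f y v = searchLoopK f ∙ searchLoopK f ∙ (succK ∙ natK y) ∙ vecK v

searchTest : ∀ {k} → Recalg (suc k) → ℕ → Vec ℕ k → Term → Term
searchTest f y v r = app (app (app r (lam (nat y))) (lam ⌊ ƛ (searchNext f y v) ⌋)) dummy

search-unfold : ∀ {k} f y (v : Vec ℕ k)
              → search f y v ⟶⁺ searchTest f y v (app (compile f) (vec (y ∷ v)))
search-unfold f y v =
  β⁺₃ (searchBody f) (closedTm (ƛ (ƛ (ƛ (searchBody f))))) (nat-closed y) (vec-closed v)
  ⁺⨾ app-congˡ (app-congˡ (app-congˡ (app-congʳ (cons-⟶ y v))))

searchTest-eval : ∀ {k} (f : Recalg (suc k)) y (v : Vec ℕ k) r
                → app (compile f) (vec (y ∷ v)) ▷ nat r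
                → searchTest f y v (app (compile f) (vec (y ∷ v))) ⟶ searchTest f y v (nat r)
searchTest-eval f y v r dr = app-congˡ (app-congˡ (app-congˡ (▷⇒⟶ dr)))

search-found : ∀ {k} f y (v : Vec ℕ k) → searchTest f y v (nat 0) ⟶ nat y
search-found f y v = nat-case-zero (natK y) (closedTm (ƛ (ƛ (searchNext f y v))))

search-next : ∀ {k} f y (v : Vec ℕ k) z → searchTest f y v (nat (suc z)) ⟶ search f (suc y) v
search-next f y v z =
  nat-case-suc z (closedTm (ƛ (natK y))) (searchNext f y v) ⨾ app-congˡ (app-congʳ (succ-⟶ y))

Denotes : ∀ {k} → Recalg k → Vec ℕ k → Term → Set
Denotes f v u = ∃ λ x → ⟦ f ⟧ v x × u ≡ nat x

PositiveBetween : ∀ {k} → Recalg (suc k) → Vec ℕ k → ℕ → ℕ → Set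
PositiveBetween f v y x = ∀ y′ → y ≤ y′ → y′ < x → ∃ λ z → ⟦ f ⟧ (y′ ∷ v) (suc z)

positiveBetween-empty : ∀ {k} (f : Recalg (suc k)) v y → PositiveBetween f v y y
positiveBetween-empty f v y y′ y≤y′ y′<y = ⊥-elim (≤⇒≯ y≤y′ y′<y)

positiveBetween-extend : ∀ {k} {f : Recalg (suc k)} {v y x z}
                       → ⟦ f ⟧ (y ∷ v) (suc z) → PositiveBetween f v (suc y) x
                       → PositiveBetween f v y x
positiveBetween-extend fy pos y′ y≤y′ y′<x with m≤n⇒m<n∨m≡n y≤y′
... | inj₁ y<y′ = pos y′ y<y′ y′<x
... | inj₂ refl = _ , fy

SearchResult : ∀ {k} → Recalg (suc k) → Vec ℕ k → ℕ → Term → Set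
SearchResult f v y u = ∃ λ x → u ≡ nat x × ⟦ f ⟧ (x ∷ v) 0 × PositiveBetween f v y x

mutual
  sound : ∀ {k} (f : Recalg k) (v : Vec ℕ k) {u} → app (compile f) (vec v) ▷ u → Denotes f v u
  sound (cst n) [] d        = n , e-cst , ⟶-value (compile-β (cst n) []) d
  sound zer v d             = 0 , e-zer , ⟶-value (compile-β zer v) d
  sound succ (n ∷ []) d     = suc n , e-succ , ⟶-value (compile-succ n) d
  sound (prj p) v d         = lookup v p , e-prj , ⟶-value (compile-prj p v) d
  sound (comp f gs) v d     = sound-comp f gs v (⟶-pres (compile-β (comp f gs) v) d)
  sound (rec f g) (m ∷ v) d = sound-rec f g v m (⟶-pres (compile-rec f g m v) d)
  sound (mu f) v d =
    let x , eq , f0 , pos = sound-search f v _ 0 (⟶-pres (compile-β (mu f) v) d) ≤-refl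
    in  x , e-mu f0 (λ y′ → pos y′ z≤n) , eq

  sound-comp : ∀ {i k} (f : Recalg k) (gs : Vec (Recalg i) k) (v : Vec ℕ i) {u}
             → app (compile f) (app (compileAll gs) (vec v)) ▷ u → Denotes (comp f gs) v u
  sound-comp f gs v d@(ev-app _ dgs _) with sound-all gs v dgs
  ... | w , gsw , refl =
    let x , fx , eq = sound f w (⟶-pres (app-congʳ (▷⇒⟶ dgs)) d) in x , e-comp w fx gsw , eq

  sound-all : ∀ {i k} (gs : Vec (Recalg i) k) (v : Vec ℕ i) {u} → app (compileAll gs) (vec v) ▷ u
            → ∃ λ w → (∀ p → ⟦ lookup gs p ⟧ v (lookup w p)) × u ≡ vec w
  sound-all [] v d = [] , (λ ()) , ⟶-value (compileAll-β [] v) d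
  sound-all (g ∷ gs) v d with ⟶-pres (compileAll-β (g ∷ gs) v) d
  ... | d′@(ev-app (ev-app _ dg _) dgs _) with sound g v dg | sound-all gs v dgs
  ...   | x , gx , refl | w , gsw , refl =
    x ∷ w , (λ { zero → gx ; (suc p) → gsw p }) , ⟶-value (compile-args g gs v x w dg dgs) d′

  sound-rec : ∀ {k} (f : Recalg k) g (v : Vec ℕ k) m {u}
            → recCall f g m v ▷ u → Denotes (rec f g) (m ∷ v) u
  sound-rec f g v zero d =
    let x , fx , eq = sound f v (⟶-pres (recCall-zero f g v) d) in x , e-rec0 fx , eq
  sound-rec f g v (suc m) d with ⟶-pres (recCall-suc f g m v) d
  ... | d′@(ev-app _ (ev-app _ (ev-app (ev-app _ dr _) _ _) _) _) with sound-rec f g v m dr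
  ...   | y , ry , refl =
    let x , gx , eq = sound g (m ∷ y ∷ v) (⟶-pres (recCall-args f g m v y dr) d′)
    in  x , e-recS y ry gx , eq

  sound-search : ∀ {k} (f : Recalg (suc k)) (v : Vec ℕ k) n y {u} (d : search f y v ▷ u)
               → size d ≤ n → SearchResult f v y u
  sound-search f v n y d d≤n =
    let d′ , d′<d = forward⁺ (search-unfold f y v) d in sound-test f v n y d′ (≤-trans d′<d d≤n)

  sound-test : ∀ {k} (f : Recalg (suc k)) (v : Vec ℕ k) n y {u}
               (d : searchTest f y v (app (compile f) (vec (y ∷ v))) ▷ u)
             → size d < n → SearchResult f v y u
  sound-test f v (suc n) y d@(ev-app (ev-app (ev-app dr _ _) _ _) _ _) (s≤s d≤n)
    with sound f (y ∷ v) dr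
  ... | zero , f0 , refl =
    y , ⟶-value (searchTest-eval f y v 0 dr ⨾ search-found f y v) d , f0 ,
    positiveBetween-empty f v y
  ... | suc z , fz , refl =
    let d′ , d′≤d = forward (searchTest-eval f y v (suc z) dr ⨾ search-next f y v z) d
        x , eq , f0 , pos = sound-search f v n (suc y) d′ (≤-trans d′≤d d≤n)
    in  x , eq , f0 , positiveBetween-extend fz pos

mutual
  complete : ∀ {k} (f : Recalg k) (v : Vec ℕ k) {x} → ⟦ f ⟧ v x → app (compile f) (vec v) ▷ nat x
  complete (cst n) [] e-cst     = ⟶-eval (compile-β (cst n) [])
  complete zer v e-zer          = ⟶-eval (compile-β zer v)
  complete succ (n ∷ []) e-succ = ⟶-eval (compile-succ n)
  complete (prj p) v e-prj      = ⟶-eval (compile-prj p v)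
  complete (comp f gs) v (e-comp w fx gsw) =
    backward (compile-β (comp f gs) v ⨾ app-congʳ (▷⇒⟶ (complete-all gs v w gsw))) (complete f w fx)
  complete (rec f g) (m ∷ v) e = backward (compile-rec f g m v) (complete-rec f g v m e)
  complete (mu f) v {x} (e-mu f0 pos) =
    backward (compile-β (mu f) v) (complete-search f v x 0 (+-identityʳ x) f0 (λ y′ _ → pos y′))

  complete-all : ∀ {i k} (gs : Vec (Recalg i) k) (v : Vec ℕ i) (w : Vec ℕ k)
               → (∀ p → ⟦ lookup gs p ⟧ v (lookup w p)) → app (compileAll gs) (vec v) ▷ vec w
  complete-all [] v [] _ = ⟶-eval (compileAll-β [] v)
  complete-all (g ∷ gs) v (x ∷ w) gsw =
    ⟶-eval (compileAll-β (g ∷ gs) v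
            ⨾ compile-args g gs v x w (complete g v (gsw zero))
                                      (complete-all gs v w (λ p → gsw (suc p))))

  complete-rec : ∀ {k} (f : Recalg k) g (v : Vec ℕ k) m {x}
               → ⟦ rec f g ⟧ (m ∷ v) x → recCall f g m v ▷ nat x
  complete-rec f g v zero (e-rec0 fx) = backward (recCall-zero f g v) (complete f v fx)
  complete-rec f g v (suc m) (e-recS y ry gx) =
    backward (recCall-suc f g m v ⨾ recCall-args f g m v y (complete-rec f g v m ry))
             (complete g (m ∷ y ∷ v) gx)

  complete-search : ∀ {k} (f : Recalg (suc k)) (v : Vec ℕ k) {x} d y → d + y ≡ x
                  → ⟦ f ⟧ (x ∷ v) 0 → PositiveBetween f v y x → search f y v ▷ nat x
  complete-search f v zero y refl f0 _ =
    backward⁺ (search-unfold f y v)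
              (⟶-eval (searchTest-eval f y v 0 (complete f (y ∷ v) f0) ⨾ search-found f y v))
  complete-search f v (suc d) y refl f0 pos =
    let z , fz = pos y ≤-refl (s≤s (m≤n+m y d))
    in  backward⁺ (search-unfold f y v)
          (backward (searchTest-eval f y v (suc z) (complete f (y ∷ v) fz) ⨾ search-next f y v z)
                    (complete-search f v d (suc y) (+-suc d y) f0 (λ y′ y<y′ → pos y′ (<⇒≤ y<y′))))

theorem11p4 : μ-rec ⪯ WCBV
theorem11p4 =
  (λ { (k , f , v) → app (compile f) (vec v) }) ,
  λ { (k , f , v) → mk⇔ (λ { (x , fx) → nat x , complete f v fx })
                        (λ { (_ , d) → let x , fx , _ = sound f v d in x , fx }) }
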